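{- Let $A\subset\mathbb{N}$ and $n\in\mathbb{N}$ with $n\notin A$. Then the following are equivalent: (a) for every $a\in\mathbb{N}$, if $an\in\Pr(A)$ then $an\in\Pr(A\cup\{n\})$; (b) $A\prec A\cup\{n\}$.
   Context: For $n\in\mathbb{N}$, $D(n)$ is the set of positive divisors of $n$. For $A\subset\mathbb{N}$, $S_A=\sum_{a\in A}a$ ($S_\emptyset=0$, $S_A=+\infty$ for infinite $A$), and $A$ is a practical set if every non-negative integer $k\le S_A$ is a sum of distinct elements of $A$. A number $m\in\mathbb{N}$ is $A$-practical if $D(m)\cap A$ is a practical set, and $\Pr(A)$ is the set of all $A$-practical numbers. For $A,A'\subset\mathbb{N}$, $A\prec A'$ means $A\subseteq A'$ and $\Pr(A)\subseteq\Pr(A')$. -}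

module Defs where

open import Data.Nat using (ℕ; zero; suc; _≤_; _≡ᵇ_)
open import Data.Nat.Divisibility using (_∣_; _∣?_)
open import Data.Bool using (Bool; true; false; _∨_; T)
open import Data.List using (List; filter; map; upTo)
open import Data.Nat.ListAction using (sum)
open import Data.List.Relation.Binary.Sublist.Propositional using (_⊆_)
open import Data.Product using (Σ; _×_)
open import Relation.Nullary.Decidable using (T?; _×-dec_)
open import Relation.Binary.PropositionalEquality using (_≡_)

Subset : Set
Subset = ℕ → Bool

_∈ₛ_ : ℕ → Subset → Set
x ∈ₛ A = A x ≡ true

_∪⁅_⁆ : Subset → ℕ → Subset
(A ∪⁅ n ⁆) x = A x ∨ (x ≡ᵇ n)

_⊆ₛ_ : Subset → Subset → Set
A ⊆ₛ B = ∀ x → x ∈ₛ A → x ∈ₛ B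

range1 : ℕ → List ℕ
range1 m = map suc (upTo m)

-- D(m) ∩ A, as a list of distinct elements in increasing order (for m ≥ 1)
divsIn : Subset → ℕ → List ℕ
divsIn A m = filter (λ d → (d ∣? m) ×-dec T? (A d)) (range1 m)

-- A finite set (given as a duplicate-free list B) is practical if every
-- k ≤ S_B is a sum of distinct elements of B, i.e. the sum of a sublist of B.
Practical : List ℕ → Set
Practical B = ∀ k → k ≤ sum B → Σ (List ℕ) (λ C → (C ⊆ B) × (sum C ≡ k))

APractical : Subset → ℕ → Set
APractical A m = Practical (divsIn A m)

_≺_ : Subset → Subset → Set
A ≺ A' = (A ⊆ₛ A') × (∀ m → 1 ≤ m → APractical A m → APractical A' m)

-- Adding n to A can only change D(m) ∩ A when n ∣ m, so for every m not
-- divisible by n the two divisor sets coincide; hence Pr(A) ⊆ Pr(A ∪ {n})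
-- needs to be checked only on the multiples a n of n.
module Submission where

open import Defs
open import Data.Nat using (ℕ; suc; _≤_; _*_; s≤s; z≤n)
open import Data.Nat.Properties using (≡ᵇ⇒≡; *-mono-≤)
open import Data.Nat.Divisibility using (_∣_; _∣?_; divides)
open import Data.Bool using (false; T)
open import Data.Bool.Properties using (T-∨)
open import Data.Sum using (inj₁; inj₂)
open import Data.Product using (_,_)
open import Data.List.Properties using (filter-≐)
open import Function.Bundles using (_⇔_; mk⇔; Equivalence)
open import Relation.Nullary using (¬_; yes; no; contradiction)
open import Relation.Nullary.Decidable using (T?; _×-dec_)
open import Relation.Binary.PropositionalEquality using (_≡_; refl; subst)

⊆-∪⁅⁆ : (A : Subset) (n : ℕ) → A ⊆ₛ (A ∪⁅ n ⁆)
⊆-∪⁅⁆ A n x x∈A rewrite x∈A = refl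

T-∪⁅⁆-∤ : (A : Subset) {n m d : ℕ} → ¬ n ∣ m → d ∣ m → T ((A ∪⁅ n ⁆) d) → T (A d)
T-∪⁅⁆-∤ A {n} {d = d} n∤m d∣m t with Equivalence.to T-∨ t
... | inj₁ d∈A = d∈A
... | inj₂ d≡ᵇn with ≡ᵇ⇒≡ d n d≡ᵇn
...   | refl = contradiction d∣m n∤m

divsIn-∪⁅⁆-∤ : (A : Subset) {n m : ℕ} → ¬ n ∣ m → divsIn A m ≡ divsIn (A ∪⁅ n ⁆) m
divsIn-∪⁅⁆-∤ A {n} {m} n∤m =
  filter-≐ (λ d → (d ∣? m) ×-dec T? (A d)) (λ d → (d ∣? m) ×-dec T? ((A ∪⁅ n ⁆) d))
    ( (λ {d} (d∣m , d∈A) → d∣m , Equivalence.from T-∨ (inj₁ d∈A))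
    , (λ (d∣m , d∈A∪n) → d∣m , T-∪⁅⁆-∤ A n∤m d∣m d∈A∪n) )
    (range1 m)

APractical-∪⁅⁆-∤ : (A : Subset) {n m : ℕ} → ¬ n ∣ m → APractical A m → APractical (A ∪⁅ n ⁆) m
APractical-∪⁅⁆-∤ A n∤m = subst Practical (divsIn-∪⁅⁆-∤ A n∤m)

1≤m*n⇒1≤m : ∀ m n → 1 ≤ m * n → 1 ≤ m
1≤m*n⇒1≤m (suc m) n _ = s≤s z≤n

Pr-⊆-of-multiples : (A : Subset) (n : ℕ) →
  (∀ a → 1 ≤ a → APractical A (a * n) → APractical (A ∪⁅ n ⁆) (a * n)) →
  ∀ m → 1 ≤ m → APractical A m → APractical (A ∪⁅ n ⁆) m
Pr-⊆-of-multiples A n onMultiples m 1≤m m∈PrA with n ∣? m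
... | no n∤m = APractical-∪⁅⁆-∤ A n∤m m∈PrA
... | yes (divides a refl) = onMultiples a (1≤m*n⇒1≤m a n 1≤m) m∈PrA

theorem3p15 : (A : Subset) → A 0 ≡ false → (n : ℕ) → 1 ≤ n → A n ≡ false →
    ((∀ a → 1 ≤ a → APractical A (a * n) → APractical (A ∪⁅ n ⁆) (a * n))
      ⇔ (A ≺ (A ∪⁅ n ⁆)))
theorem3p15 A _ n 1≤n _ = mk⇔
  (λ onMultiples → ⊆-∪⁅⁆ A n , Pr-⊆-of-multiples A n onMultiples)
  (λ (_ , Pr-⊆) a 1≤a → Pr-⊆ (a * n) (*-mono-≤ 1≤a 1≤n))
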